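{- Let $G\in\mathcal{G}(n)$. For any computation schedule evaluating $G$ in the two-level memory model with a cache of $M$ words and block size $B\ge 1$, in which no vertex value is computed more than once, the number of I/O operations is at least $$IO_G(n,M,B)\ \ge\ \max\left\{\frac{n^3-n}{16\sqrt{M}}-\frac{n(n+1)}{2}-3M,\ n\right\}\frac{1}{B}.$$
   Context: For a positive integer $n$, the family $\mathcal{G}(n)$ consists of all CDAGs (computational DAGs) built as follows. There are $R$-vertices $v_{i,j}$ for all $1\le i\le j\le n$; the vertices $v_{i,i}$ are the input vertices. For every pair $i<j$ the CDAG contains a directed binary tree with exactly $j-i$ leaves, all of whose edges are directed towards its root $v_{i,j}$; the shape of each tree is arbitrary and trees for distinct pairs are vertex-disjoint. For $k\in\{0,\dots,j-i-1\}$ the $k$-th leaf of the tree rooted at $v_{i,j}$ has exactly two predecessors, $v_{i,i+k}$ and $v_{i+k+1,j}$. Memory model: a cache of $M$ words and a slow memory of unbounded size; each vertex value occupies one word; the value of a vertex can be computed only when the values of all its predecessors are in the cache, and the result is placed in the cache; the inputs are initially only in slow memory; a read (resp. write) I/O operation moves up to $B$ words stored in consecutive locations from slow memory to cache (resp. from cache to slow memory). A computation schedule evaluates all vertices of $G$; $IO_G(n,M,B)$ is the minimum number of I/O operations over all schedules of the considered kind. Standing assumption: $n=2^a$ and $M=2^b$ for integers $a,b\ge 3$. -}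

module Defs where

open import Data.Nat using (ℕ; zero; suc; _+_; _*_; _∸_; _^_; _≤_; _<_; _≡ᵇ_)
open import Data.Bool using (if_then_else_)
open import Data.List using (List; []; _∷_; _++_; length; upTo)
open import Data.List.Membership.Propositional using (_∈_)
open import Data.List.Relation.Unary.All using (All)
open import Data.List.Relation.Binary.Permutation.Propositional using (_↭_)
open import Data.Maybe using (Maybe; just; nothing)
open import Data.Product using (Σ; _×_; _,_)
open import Data.Unit using (⊤)
open import Data.Empty using (⊥)
open import Relation.Binary.PropositionalEquality using (_≡_)
open import Relation.Nullary using (¬_)

data Tree : Set where
  leaf : ℕ → Tree
  node : Tree → Tree → Tree

leaves : Tree → List ℕ
leaves (leaf k)   = k ∷ []
leaves (node l r) = leaves l ++ leaves r

-- Positions (= vertices) in a tree; 'here' is the root of the (sub)tree.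
data Pos : Tree → Set where
  here : ∀ {t} → Pos t
  inl  : ∀ {l r} → Pos l → Pos (node l r)
  inr  : ∀ {l r} → Pos r → Pos (node l r)

-- Indices are 0-based: the paper's
-- v_{i,j} (1 ≤ i ≤ j ≤ n) is our v_{i-1,j-1}.  For a pair i < j we write
-- j = i + suc d; the tree rooted at v_{i,j} has shape 'shape i d', whose
-- leaves are labelled by a permutation of 0,…,d (= j-i-1), i.e. the tree
-- has exactly j-i leaves, each label k ∈ {0,…,j-i-1} used exactly once.

record Family (n : ℕ) : Set where
  field
    shape  : ℕ → ℕ → Tree
    labels : ∀ i d → i + suc d < n → leaves (shape i d) ↭ upTo (suc d)

module CDAG {n : ℕ} (G : Family n) where
  open Family G

  -- inp i     : the input vertex v_{i,i}
  -- tn i d p  : vertex at position p of the tree rooted at v_{i,i+d+1};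
  --             tn i d here is v_{i,i+d+1} itself.
  data Vtx : Set where
    inp : ℕ → Vtx
    tn  : (i d : ℕ) → Pos (shape i d) → Vtx

  vOff : ℕ → ℕ → Vtx
  vOff i zero    = inp i
  vOff i (suc d) = tn i d here

  -- vertices actually belonging to the CDAG (indices in range)
  Valid : Vtx → Set
  Valid (inp i)    = i < n
  Valid (tn i d _) = i + suc d < n

  IsInput : Vtx → Set
  IsInput (inp _)    = ⊤
  IsInput (tn _ _ _) = ⊥

  -- predecessors: an internal tree node has its two children as
  -- predecessors; the leaf labelled k of the tree rooted at v_{i,j}
  -- (j = i + suc d) has predecessors v_{i,i+k} and v_{i+k+1,j}.
  predsAux : (i d : ℕ) (t : Tree) → (Pos t → Pos (shape i d)) → Pos t → List Vtx
  predsAux i d (leaf k)   w here    = vOff i k ∷ vOff (i + suc k) (d ∸ k) ∷ []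
  predsAux i d (node l r) w here    = tn i d (w (inl here)) ∷ tn i d (w (inr here)) ∷ []
  predsAux i d (node l r) w (inl p) = predsAux i d l (λ q → w (inl q)) p
  predsAux i d (node l r) w (inr p) = predsAux i d r (λ q → w (inr q)) p

  preds : Vtx → List Vtx
  preds (inp _)    = []
  preds (tn i d p) = predsAux i d (shape i d) (λ q → q) p

  Mem : Set
  Mem = ℕ → Maybe Vtx

  -- Cache: list of the words currently held (its length = words used).
  record State : Set where
    constructor st
    field
      cache : List Vtx
      mem   : Mem

  data Op : Set where
    compute : Vtx → Op
    read    : ℕ → List Vtx → Op   -- read the words at addresses a, a+1, …
    write   : ℕ → List Vtx → Op   -- write words to addresses a, a+1, …
    delete  : Vtx → Op

  Consec : Mem → ℕ → List Vtx → Set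
  Consec m a []       = ⊤
  Consec m a (w ∷ ws) = (m a ≡ just w) × Consec m (suc a) ws

  writeAt : Mem → ℕ → List Vtx → Mem
  writeAt m a []       = m
  writeAt m a (v ∷ vs) = writeAt (λ b → if b ≡ᵇ a then just v else m b) (suc a) vs

  data Step (M B : ℕ) : State → Op → State → Set where
    stepCompute : ∀ {c m v} → Valid v → ¬ IsInput v → All (_∈ c) (preds v) →
                  length (v ∷ c) ≤ M →
                  Step M B (st c m) (compute v) (st (v ∷ c) m)
    stepRead    : ∀ {c m a ws} → 1 ≤ length ws → length ws ≤ B → Consec m a ws →
                  length (ws ++ c) ≤ M →
                  Step M B (st c m) (read a ws) (st (ws ++ c) m)
    stepWrite   : ∀ {c m a ws} → 1 ≤ length ws → length ws ≤ B → All (_∈ c) ws →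
                  Step M B (st c m) (write a ws) (st c (writeAt m a ws))
    stepDelete  : ∀ {xs ys m v} →
                  Step M B (st (xs ++ v ∷ ys) m) (delete v) (st (xs ++ ys) m)

  data Run (M B : ℕ) : State → List Op → State → Set where
    done : ∀ {s} → Run M B s [] s
    _∷_  : ∀ {s o s′ os s″} → Step M B s o s′ → Run M B s′ os s″ → Run M B s (o ∷ os) s″

  InitMem : Mem → Set
  InitMem m0 =
    (∀ a v → m0 a ≡ just v → Σ ℕ λ i → (i < n) × (v ≡ inp i)) ×
    (∀ i → i < n → Σ ℕ λ a → m0 a ≡ just (inp i)) ×
    (∀ a b i → m0 a ≡ just (inp i) → m0 b ≡ just (inp i) → a ≡ b)

  computed : List Op → List Vtx
  computed []                = []
  computed (compute v ∷ os)  = v ∷ computed os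
  computed (read _ _ ∷ os)   = computed os
  computed (write _ _ ∷ os)  = computed os
  computed (delete _ ∷ os)   = computed os

  ioCount : List Op → ℕ
  ioCount []               = 0
  ioCount (compute _ ∷ os) = ioCount os
  ioCount (read _ _ ∷ os)  = suc (ioCount os)
  ioCount (write _ _ ∷ os) = suc (ioCount os)
  ioCount (delete _ ∷ os)  = ioCount os

  EvaluatesAll : List Op → Set
  EvaluatesAll os = ∀ v → Valid v → ¬ IsInput v → v ∈ computed os

-- io ≥ max{ (n³-n)/(16√M) - n(n+1)/2 - 3M , n } / B, rewritten over ℕ:
--   n ≤ B·io   and   (n³-n)² ≤ 64·M·(2·B·io + n(n+1) + 6M)²
-- (equivalent, since both sides of the first bound are ≥ 0 after moving
--  terms, and n³ - n ≥ 0).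
IOBound : ℕ → ℕ → ℕ → ℕ → Set
IOBound n M B io =
  (n ≤ B * io) ×
  ((n ^ 3 ∸ n) ^ 2 ≤ 64 * M * (2 * (B * io) + n * (n + 1) + 6 * M) ^ 2)

{-# OPTIONS --safe #-}

-- Simulate the block schedule by single-word loads and stores; a block transfer costs at most B of them.
-- Record the leaf with label y - x of the tree rooted at v_{x,z} as the triple (x , y , z); all
-- (n³ - n)/6 triples x ≤ y < z < n occur.  Cut the word schedule into segments of cost at most 2M, where
-- cost counts loads, stores and computed tree roots.  For a leaf computed in a segment, its predecessors
-- v_{x,y} and v_{y+1,z} are available to the segment (cached at its start, loaded, or a computed root),
-- and some vertex of the tree rooted at v_{x,z} survives it (cached at its end, stored, or a computed
-- root).  Each of these three sets has at most 3M values, so by the discrete Loomis–Whitney inequality a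
-- segment computes at most (3M)^{3/2} leaves.  Hence there are at least (n³ - n)/(6 (3M)^{3/2}) segments,
-- every one but the last of cost 2M, paid for by the I/O and the at most n(n+1)/2 roots.  Finally each
-- of the n inputs is a predecessor of some leaf, so it must be loaded.
module Submission where

open import Defs
open import Data.Bool using (true; false)
open import Data.Empty using (⊥; ⊥-elim)
open import Data.List
  using (List; []; _∷_; _++_; length; map; filter; foldr; concat; concatMap; upTo; deduplicate; cartesianProduct)
open import Data.List.Properties
  using (length-++; length-++-sucʳ; length-map; length-upTo; map-++; map-cong; concat-++; concatMap-++; filter-++)
open import Data.List.Membership.Propositional using (_∈_; find; lose)
open import Data.List.Membership.Propositional.Properties
open import Data.List.Relation.Binary.Disjoint.Propositional using (Disjoint)
open import Data.List.Relation.Binary.Permutation.Propositional using (↭-sym)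
open import Data.List.Relation.Binary.Permutation.Propositional.Properties using (∈-resp-↭)
open import Data.List.Relation.Binary.Subset.Propositional using (_⊆_)
open import Data.List.Relation.Unary.All as All using (All; []; _∷_)
open import Data.List.Relation.Unary.AllPairs using ([]; _∷_)
open import Data.List.Relation.Unary.Any using (here; there)
open import Data.List.Relation.Unary.Unique.Propositional using (Unique)
import Data.List.Relation.Unary.Unique.Propositional.Properties as Unique
import Data.List.Relation.Unary.Unique.DecPropositional.Properties as DecUnique
open import Data.Maybe using (Maybe; just; nothing; maybe)
open import Data.Nat using (ℕ; zero; suc; _+_; _*_; _∸_; _^_; _≤_; _<_; _≤?_; _<?_; _≟_; _≡ᵇ_; z≤n; s≤s)
open import Data.Nat.ListAction using (sum)
open import Data.Nat.ListAction.Properties using (sum-++)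
open import Data.Nat.Properties
open import Data.Nat.Tactic.RingSolver using (solve-∀)
open import Data.Product using (Σ; ∃; ∃₂; _×_; _,_; proj₁; proj₂; map₂)
open import Data.Product.Properties using (≡-dec)
open import Data.Sum as Sum using (_⊎_; inj₁; inj₂; [_,_]′)
open import Data.Unit using (⊤; tt)
open import Function using (_∘_; case_of_)
open import Relation.Binary.Definitions using (DecidableEquality)
open import Relation.Binary.PropositionalEquality
open import Relation.Nullary using (¬_; Dec; yes; no; contradiction)
open import Relation.Unary using (Decidable)

open import Algebra.Properties.CommutativeSemigroup +-commutativeSemigroup using (interchange)

m^2≡m*m : ∀ m → m ^ 2 ≡ m * m
m^2≡m*m m = cong (m *_) (*-identityʳ m)

m*m≤n*n⇒m≤n : ∀ {m n} → m * m ≤ n * n → m ≤ n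
m*m≤n*n⇒m≤n {m} {n} m²≤n² with m ≤? n
... | yes m≤n = m≤n
... | no m≰n = contradiction m²≤n² (<⇒≱ (*-mono-< (≰⇒> m≰n) (≰⇒> m≰n)))

4mn≤[m+n]² : ∀ m n → 4 * (m * n) ≤ (m + n) * (m + n)
4mn≤[m+n]² m n = [ ordered , swap ∘ ordered ]′ (≤-total m n)
  where
  ordered : ∀ {m n} → m ≤ n → 4 * (m * n) ≤ (m + n) * (m + n)
  ordered {m} m≤n with r , refl ← m≤n⇒∃[o]m+o≡n m≤n =
    subst (4 * (m * (m + r)) ≤_) (expand m r) (m≤m+n _ (r * r))
    where
    expand : ∀ m r → 4 * (m * (m + r)) + r * r ≡ (m + (m + r)) * (m + (m + r))
    expand = solve-∀
  swap : 4 * (n * m) ≤ (n + m) * (n + m) → 4 * (m * n) ≤ (m + n) * (m + n)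
  swap = subst₂ _≤_ (cong (4 *_) (*-comm n m)) (cong₂ _*_ (+-comm n m) (+-comm n m))

m*m≤n*o⇒2m≤n+o : ∀ m n o → m * m ≤ n * o → 2 * m ≤ n + o
m*m≤n*o⇒2m≤n+o m n o m²≤no = m*m≤n*n⇒m≤n (begin
  (2 * m) * (2 * m) ≡⟨ expand m ⟩
  4 * (m * m)       ≤⟨ *-monoʳ-≤ 4 m²≤no ⟩
  4 * (n * o)       ≤⟨ 4mn≤[m+n]² n o ⟩
  (n + o) * (n + o) ∎)
  where
  open ≤-Reasoning
  expand : ∀ m → (2 * m) * (2 * m) ≡ 4 * (m * m)
  expand = solve-∀

module _ {I : Set} where

  sum-map-+ : ∀ (f g : I → ℕ) xs → sum (map (λ i → f i + g i) xs) ≡ sum (map f xs) + sum (map g xs)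
  sum-map-+ f g [] = refl
  sum-map-+ f g (x ∷ xs) rewrite sum-map-+ f g xs = interchange (f x) (g x) _ _

  sum-map-const-1 : ∀ (xs : List I) → sum (map (λ _ → 1) xs) ≡ length xs
  sum-map-const-1 [] = refl
  sum-map-const-1 (x ∷ xs) = cong suc (sum-map-const-1 xs)

  cauchy-schwarz : ∀ C (t a c : I → ℕ) xs → (∀ {i} → i ∈ xs → t i * t i ≤ C * (a i * c i)) →
    sum (map t xs) * sum (map t xs) ≤ C * (sum (map a xs) * sum (map c xs))
  cauchy-schwarz C t a c [] _ = z≤n
  cauchy-schwarz C t a c (x ∷ xs) bound = begin
    (t₀ + T) * (t₀ + T)                              ≡⟨ expand t₀ T ⟩
    t₀ * t₀ + 2 * (t₀ * T) + T * T                   ≤⟨ +-mono-≤ (+-mono-≤ head cross) tail ⟩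
    C * (a₀ * c₀) + (C * (a₀ * K) + C * (A * c₀)) + C * (A * K) ≡⟨ collect C a₀ c₀ A K ⟩
    C * ((a₀ + A) * (c₀ + K))                        ∎
    where
    open ≤-Reasoning
    t₀ = t x ; a₀ = a x ; c₀ = c x
    T = sum (map t xs) ; A = sum (map a xs) ; K = sum (map c xs)
    head = bound (here refl)
    tail = cauchy-schwarz C t a c xs (bound ∘ there)
    expand : ∀ t T → (t + T) * (t + T) ≡ t * t + 2 * (t * T) + T * T
    expand = solve-∀
    collect : ∀ C a c A K → C * (a * c) + (C * (a * K) + C * (A * c)) + C * (A * K) ≡ C * ((a + A) * (c + K))
    collect = solve-∀
    regroup₁ : ∀ t T → (t * T) * (t * T) ≡ (t * t) * (T * T)
    regroup₁ = solve-∀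
    regroup₂ : ∀ C a c A K → (C * (a * c)) * (C * (A * K)) ≡ (C * (a * K)) * (C * (A * c))
    regroup₂ = solve-∀
    cross : 2 * (t₀ * T) ≤ C * (a₀ * K) + C * (A * c₀)
    cross = m*m≤n*o⇒2m≤n+o (t₀ * T) (C * (a₀ * K)) (C * (A * c₀)) (begin
      (t₀ * T) * (t₀ * T)             ≡⟨ regroup₁ t₀ T ⟩
      (t₀ * t₀) * (T * T)             ≤⟨ *-mono-≤ head tail ⟩
      (C * (a₀ * c₀)) * (C * (A * K)) ≡⟨ regroup₂ C a₀ c₀ A K ⟩
      (C * (a₀ * K)) * (C * (A * c₀)) ∎)

injective⇒length≤ : {A B : Set} (f : A → B) {xs : List A} {ys : List B} → Unique xs →
  (∀ {a b} → a ∈ xs → b ∈ xs → f a ≡ f b → a ≡ b) → (∀ {a} → a ∈ xs → f a ∈ ys) →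
  length xs ≤ length ys
injective⇒length≤ f {[]} _ _ _ = z≤n
injective⇒length≤ f {x ∷ xs} (x∉xs ∷ xs!) inj into
  with ys₁ , ys₂ , refl ← ∈-∃++ (into (here refl)) = begin
    suc (length xs)           ≤⟨ s≤s (injective⇒length≤ f xs! (λ a b → inj (there a) (there b)) into′) ⟩
    suc (length (ys₁ ++ ys₂)) ≡⟨ length-++-sucʳ ys₁ (f x) ys₂ ⟨
    length (ys₁ ++ f x ∷ ys₂) ∎
  where
  open ≤-Reasoning
  into′ : ∀ {a} → a ∈ xs → f a ∈ ys₁ ++ ys₂
  into′ {a} a∈xs with ∈-++⁻ ys₁ (into (there a∈xs))
  ... | inj₁ p = ∈-++⁺ˡ p
  ... | inj₂ (there p) = ∈-++⁺ʳ ys₁ p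
  ... | inj₂ (here fa≡fx) = contradiction (sym (inj (there a∈xs) (here refl) fa≡fx)) (All.lookup x∉xs a∈xs)

length-cartesianProduct : {A B : Set} (xs : List A) (ys : List B) →
  length (cartesianProduct xs ys) ≡ length xs * length ys
length-cartesianProduct [] ys = refl
length-cartesianProduct (x ∷ xs) ys = trans (length-++ (map (x ,_) ys))
  (cong₂ _+_ (length-map (x ,_) ys) (length-cartesianProduct xs ys))

module _ {A : Set} where

  Unique[xs++ys]⇒Disjoint : ∀ xs {ys : List A} → Unique (xs ++ ys) → Disjoint xs ys
  Unique[xs++ys]⇒Disjoint (x ∷ xs) (x∉ ∷ _) (here refl , v∈ys) = All.lookup x∉ (∈-++⁺ʳ xs v∈ys) refl
  Unique[xs++ys]⇒Disjoint (x ∷ xs) (_ ∷ u) (there v∈xs , v∈ys) = Unique[xs++ys]⇒Disjoint xs u (v∈xs , v∈ys)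

  Unique[xs++ys]⇒Unique[ys] : ∀ xs {ys : List A} → Unique (xs ++ ys) → Unique ys
  Unique[xs++ys]⇒Unique[ys] [] u = u
  Unique[xs++ys]⇒Unique[ys] (x ∷ xs) (_ ∷ u) = Unique[xs++ys]⇒Unique[ys] xs u

  xs++ys⊆xs++v∷ys : ∀ (xs : List A) {v ys} → xs ++ ys ⊆ xs ++ v ∷ ys
  xs++ys⊆xs++v∷ys xs u∈ with ∈-++⁻ xs u∈
  ... | inj₁ u∈xs = ∈-++⁺ˡ u∈xs
  ... | inj₂ u∈ys = ∈-++⁺ʳ xs (there u∈ys)

  length[xs++ys]≤length[xs++v∷ys] : ∀ (xs : List A) {v ys} → length (xs ++ ys) ≤ length (xs ++ v ∷ ys)
  length[xs++ys]≤length[xs++v∷ys] xs {v} {ys} = ≤-trans (n≤1+n _) (≤-reflexive (sym (length-++-sucʳ xs v ys)))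

module Fibres {I A : Set} (_∼_ : I → A → Set) (_∼?_ : ∀ i → Decidable (i ∼_)) where

  fibre : List A → I → List A
  fibre T i = filter (i ∼?_) T

  hits : A → I → ℕ
  hits t = length ∘ fibre (t ∷ [])

  ∑fibre : List I → List A → ℕ
  ∑fibre Is T = sum (map (length ∘ fibre T) Is)

  ∑fibre-[] : ∀ Is → ∑fibre Is [] ≡ 0
  ∑fibre-[] [] = refl
  ∑fibre-[] (_ ∷ Is) = ∑fibre-[] Is

  ∑fibre-∷ : ∀ Is t T → ∑fibre Is (t ∷ T) ≡ sum (map (hits t) Is) + ∑fibre Is T
  ∑fibre-∷ Is t T = trans (cong sum (map-cong length-fibre-∷ Is)) (sum-map-+ (hits t) _ Is)
    where
    length-fibre-∷ : ∀ i → length (fibre (t ∷ T) i) ≡ hits t i + length (fibre T i)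
    length-fibre-∷ i with i ∼? t
    ... | yes _ = refl
    ... | no _ = refl

  1≤∑hits : ∀ {i t} Is → i ∈ Is → i ∼ t → 1 ≤ sum (map (hits t) Is)
  1≤∑hits {i} {t} (_ ∷ Is) (here refl) i∼t with i ∼? t
  ... | yes _ = s≤s z≤n
  ... | no i≁t = contradiction i∼t i≁t
  1≤∑hits (_ ∷ Is) (there i∈Is) i∼t = ≤-trans (1≤∑hits Is i∈Is i∼t) (m≤n+m _ _)

  ∑hits≡0 : ∀ t Is → (∀ {j} → j ∈ Is → ¬ j ∼ t) → sum (map (hits t) Is) ≡ 0
  ∑hits≡0 t [] _ = refl
  ∑hits≡0 t (j ∷ Is) none with j ∼? t
  ... | yes j∼t = contradiction j∼t (none (here refl))
  ... | no _ = ∑hits≡0 t Is (none ∘ there)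

  ∑hits≤1 : ∀ t Is → Unique Is → (∀ {i j} → i ∼ t → j ∼ t → i ≡ j) → sum (map (hits t) Is) ≤ 1
  ∑hits≤1 t [] _ _ = z≤n
  ∑hits≤1 t (i ∷ Is) (i∉Is ∷ Is!) unique with i ∼? t
  ... | yes i∼t = ≤-reflexive (cong suc (∑hits≡0 t Is λ j∈Is j∼t →
                    All.lookup i∉Is j∈Is (unique i∼t j∼t)))
  ... | no _ = ∑hits≤1 t Is Is! unique

  length≤∑fibre : ∀ Is T → (∀ {t} → t ∈ T → ∃ λ i → i ∈ Is × i ∼ t) → length T ≤ ∑fibre Is T
  length≤∑fibre Is [] _ = z≤n
  length≤∑fibre Is (t ∷ T) covered with i , i∈Is , i∼t ← covered (here refl) =
    subst (suc (length T) ≤_) (sym (∑fibre-∷ Is t T))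
      (+-mono-≤ (1≤∑hits Is i∈Is i∼t) (length≤∑fibre Is T (covered ∘ there)))

  ∑fibre≤length : ∀ Is T → Unique Is → (∀ {i j t} → i ∼ t → j ∼ t → i ≡ j) → ∑fibre Is T ≤ length T
  ∑fibre≤length Is [] _ _ = ≤-reflexive (∑fibre-[] Is)
  ∑fibre≤length Is (t ∷ T) Is! unique = subst (_≤ suc (length T)) (sym (∑fibre-∷ Is t T))
    (+-mono-≤ (∑hits≤1 t Is Is! unique) (∑fibre≤length Is T Is! unique))

module _ {A B C : Set} (_≟_ : DecidableEquality A) where

  -- The x-fibre of T injects both into P₂ (via (y , z)) and into P₁ˣ × P₃ˣ (via ((x , y) , (x , z))),
  -- so |Tˣ|² ≤ |P₂| |P₁ˣ| |P₃ˣ|; Cauchy–Schwarz over x finishes.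
  loomis-whitney : (T : List (A × B × C)) → Unique T →
    (P₁ : List (A × B)) (P₂ : List (B × C)) (P₃ : List (A × C)) →
    (∀ {x y z} → (x , y , z) ∈ T → (x , y) ∈ P₁ × (y , z) ∈ P₂ × (x , z) ∈ P₃) →
    length T * length T ≤ length P₂ * (length P₁ * length P₃)
  loomis-whitney T T! P₁ P₂ P₃ proj = begin
    length T * length T     ≤⟨ *-mono-≤ T≤∑ T≤∑ ⟩
    ∑T * ∑T                 ≤⟨ cauchy-schwarz (length P₂) (length ∘ Fᵀ.fibre T)
                                 (length ∘ F¹.fibre P₁) (length ∘ F³.fibre P₃) X
                                 (λ {x} _ → *-mono-≤ (fibre≤P₂ x) (fibre≤P₁×P₃ x)) ⟩
    length P₂ * (F¹.∑fibre X P₁ * F³.∑fibre X P₃)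
                            ≤⟨ *-monoʳ-≤ (length P₂) (*-mono-≤ ∑P₁≤ ∑P₃≤) ⟩
    length P₂ * (length P₁ * length P₃) ∎
    where
    open ≤-Reasoning
    module Fᵀ = Fibres (λ x (t : A × B × C) → proj₁ t ≡ x) (λ x t → proj₁ t ≟ x)
    module F¹ = Fibres (λ x (p : A × B) → proj₁ p ≡ x) (λ x p → proj₁ p ≟ x)
    module F³ = Fibres (λ x (p : A × C) → proj₁ p ≡ x) (λ x p → proj₁ p ≟ x)
    X = deduplicate _≟_ (map proj₁ T)
    X! = DecUnique.deduplicate-! _≟_ (map proj₁ T)
    ∑T = Fᵀ.∑fibre X T
    same-key : ∀ {D : Set} {x y : A} {p : A × D} → proj₁ p ≡ x → proj₁ p ≡ y → x ≡ y
    same-key p≡x p≡y = trans (sym p≡x) p≡y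
    ∑P₁≤ : F¹.∑fibre X P₁ ≤ length P₁
    ∑P₁≤ = F¹.∑fibre≤length X P₁ X! λ {_ _ p} → same-key {p = p}
    ∑P₃≤ : F³.∑fibre X P₃ ≤ length P₃
    ∑P₃≤ = F³.∑fibre≤length X P₃ X! λ {_ _ p} → same-key {p = p}
    T≤∑ : length T ≤ ∑T
    T≤∑ = Fᵀ.length≤∑fibre X T (λ {t} t∈T → proj₁ t , ∈-deduplicate⁺ _≟_ (∈-map⁺ proj₁ t∈T) , refl)
    Tˣ! : ∀ x → Unique (Fᵀ.fibre T x)
    Tˣ! x = Unique.filter⁺ (λ t → proj₁ t ≟ x) T!
    inTˣ : ∀ {x t} → t ∈ Fᵀ.fibre T x → t ∈ T × proj₁ t ≡ x
    inTˣ {x} = ∈-filter⁻ (λ t → proj₁ t ≟ x)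
    fibre≤P₂ : ∀ x → length (Fᵀ.fibre T x) ≤ length P₂
    fibre≤P₂ x = injective⇒length≤ (λ (_ , y , z) → y , z) (Tˣ! x)
      (λ { {_ , y , z} a b refl → cong (_, y , z) (trans (proj₂ (inTˣ a)) (sym (proj₂ (inTˣ b)))) })
      (λ t∈ → proj₁ (proj₂ (proj (proj₁ (inTˣ t∈)))))
    fibre≤P₁×P₃ : ∀ x → length (Fᵀ.fibre T x) ≤ length (F¹.fibre P₁ x) * length (F³.fibre P₃ x)
    fibre≤P₁×P₃ x = begin
      length (Fᵀ.fibre T x) ≤⟨ injective⇒length≤ (λ (x , y , z) → (x , y) , (x , z)) (Tˣ! x)
                                 (λ { _ _ refl → refl })
                                 (λ t∈ → let t∈T , t≡x = inTˣ t∈ ; p₁ , _ , p₃ = proj t∈T in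
                                   ∈-cartesianProduct⁺ (∈-filter⁺ (λ p → proj₁ p ≟ x) p₁ t≡x)
                                                       (∈-filter⁺ (λ p → proj₁ p ≟ x) p₃ t≡x)) ⟩
      length (cartesianProduct (F¹.fibre P₁ x) (F³.fibre P₃ x))
                            ≡⟨ length-cartesianProduct (F¹.fibre P₁ x) (F³.fibre P₃ x) ⟩
      length (F¹.fibre P₁ x) * length (F³.fibre P₃ x) ∎

pairs≤ : ℕ → List (ℕ × ℕ)
pairs≤ zero = []
pairs≤ (suc m) = pairs≤ m ++ map (_, m) (upTo (suc m))

triples : ℕ → List (ℕ × ℕ × ℕ)
triples zero = []
triples (suc m) = triples m ++ map (λ (x , y) → x , y , m) (pairs≤ m)

∈-pairs≤⁻ : ∀ m {x y} → (x , y) ∈ pairs≤ m → x ≤ y × y < m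
∈-pairs≤⁻ (suc m) xy∈ with ∈-++⁻ (pairs≤ m) xy∈
... | inj₁ xy∈′ = map₂ m<n⇒m<1+n (∈-pairs≤⁻ m xy∈′)
... | inj₂ xm∈ with _ , x∈ , refl ← ∈-map⁻ (_, m) xm∈ = ≤-pred (∈-upTo⁻ x∈) , ≤-refl

∈-pairs≤⁺ : ∀ {m x y} → x ≤ y → y < m → (x , y) ∈ pairs≤ m
∈-pairs≤⁺ {suc m} x≤y y<1+m with m≤n⇒m<n∨m≡n (≤-pred y<1+m)
... | inj₁ y<m = ∈-++⁺ˡ (∈-pairs≤⁺ x≤y y<m)
... | inj₂ refl = ∈-++⁺ʳ (pairs≤ m) (∈-map⁺ (_, m) (∈-upTo⁺ (s≤s x≤y)))

∈-triples⁻ : ∀ m {x y z} → (x , y , z) ∈ triples m → x ≤ y × y < z × z < m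
∈-triples⁻ (suc m) t∈ with ∈-++⁻ (triples m) t∈
... | inj₁ t∈′ = map₂ (map₂ m<n⇒m<1+n) (∈-triples⁻ m t∈′)
... | inj₂ t∈′ with _ , xy∈ , refl ← ∈-map⁻ (λ (x , y) → x , y , m) t∈′ =
  map₂ (_, ≤-refl) (∈-pairs≤⁻ m xy∈)

pairs≤-unique : ∀ m → Unique (pairs≤ m)
pairs≤-unique zero = []
pairs≤-unique (suc m) = Unique.++⁺ (pairs≤-unique m) (Unique.map⁺ (cong proj₁) (Unique.upTo⁺ (suc m)))
  λ (xy∈ , xm∈) → case ∈-map⁻ (_, m) xm∈ of λ where
    (_ , _ , refl) → <-irrefl refl (proj₂ (∈-pairs≤⁻ m xy∈))

triples-unique : ∀ m → Unique (triples m)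
triples-unique zero = []
triples-unique (suc m) = Unique.++⁺ (triples-unique m)
  (Unique.map⁺ (λ { refl → refl }) (pairs≤-unique m))
  λ (t∈ , tm∈) → case ∈-map⁻ (λ (x , y) → x , y , m) tm∈ of λ where
    (_ , _ , refl) → <-irrefl refl (proj₂ (proj₂ (∈-triples⁻ m t∈)))

length-pairs≤ : ∀ m → 2 * length (pairs≤ m) ≡ m * (m + 1)
length-pairs≤ zero = refl
length-pairs≤ (suc m) = begin
  2 * length (pairs≤ m ++ map (_, m) (upTo (suc m)))           ≡⟨ cong (2 *_) (length-++ (pairs≤ m)) ⟩
  2 * (length (pairs≤ m) + length (map (_, m) (upTo (suc m)))) ≡⟨ cong (λ l → 2 * (length (pairs≤ m) + l)) new ⟩
  2 * (length (pairs≤ m) + suc m)                              ≡⟨ *-distribˡ-+ 2 (length (pairs≤ m)) (suc m) ⟩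
  2 * length (pairs≤ m) + 2 * suc m                            ≡⟨ cong (_+ 2 * suc m) (length-pairs≤ m) ⟩
  m * (m + 1) + 2 * suc m                                      ≡⟨ step m ⟩
  suc m * (suc m + 1)                                          ∎
  where
  open ≡-Reasoning
  new : length (map (_, m) (upTo (suc m))) ≡ suc m
  new = trans (length-map (_, m) (upTo (suc m))) (length-upTo (suc m))
  step : ∀ m → m * (m + 1) + 2 * suc m ≡ suc m * (suc m + 1)
  step = solve-∀

length-triples : ∀ m → 6 * length (triples m) + m ≡ m * (m * m)
length-triples zero = refl
length-triples (suc m) = begin
  6 * length (triples m ++ map _ (pairs≤ m)) + suc m ≡⟨ cong (λ l → 6 * l + suc m) length-step ⟩
  6 * (T + P) + suc m                                ≡⟨ regroup T P m ⟩
  (6 * T + m) + 3 * (2 * P) + 1                      ≡⟨ cong₂ (λ a b → a + 3 * b + 1) (length-triples m) (length-pairs≤ m) ⟩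
  m * (m * m) + 3 * (m * (m + 1)) + 1                ≡⟨ step m ⟩
  suc m * (suc m * suc m)                            ∎
  where
  open ≡-Reasoning
  T = length (triples m)
  P = length (pairs≤ m)
  length-step : length (triples m ++ map (λ (x , y) → x , y , m) (pairs≤ m)) ≡ T + P
  length-step = trans (length-++ (triples m)) (cong (T +_) (length-map _ (pairs≤ m)))
  regroup : ∀ T P m → 6 * (T + P) + suc m ≡ (6 * T + m) + 3 * (2 * P) + 1
  regroup = solve-∀
  step : ∀ m → m * (m * m) + 3 * (m * (m + 1)) + 1 ≡ suc m * (suc m * suc m)
  step = solve-∀

n³∸n≡6*length-triples : ∀ n → n ^ 3 ∸ n ≡ 6 * length (triples n)
n³∸n≡6*length-triples n = begin
  n ^ 3 ∸ n                        ≡⟨ cong (λ y → n * (n * y) ∸ n) (*-identityʳ n) ⟩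
  n * (n * n) ∸ n                  ≡⟨ cong (_∸ n) (length-triples n) ⟨
  6 * length (triples n) + n ∸ n   ≡⟨ m+n∸n≡m _ n ⟩
  6 * length (triples n)           ∎
  where open ≡-Reasoning

module Chunking {E : Set} (w : E → ℕ) (w≤1 : ∀ e → w e ≤ 1) (K : ℕ) where

  weight : List E → ℕ
  weight = sum ∘ map w

  weight-++ : ∀ xs ys → weight (xs ++ ys) ≡ weight xs + weight ys
  weight-++ xs ys = trans (cong sum (map-++ w xs ys)) (sum-++ (map w xs) (map w ys))

  push : E → List (List E) → List (List E)
  push e [] = (e ∷ []) ∷ []
  push e (c ∷ cs) with weight (e ∷ c) ≤? K
  ... | yes _ = (e ∷ c) ∷ cs
  ... | no _ = (e ∷ []) ∷ c ∷ cs

  chunks : List E → List (List E)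
  chunks = foldr push []

  concat-chunks : ∀ es → concat (chunks es) ≡ es
  concat-chunks [] = refl
  concat-chunks (e ∷ es) = trans (concat-push (chunks es)) (cong (e ∷_) (concat-chunks es))
    where
    concat-push : ∀ cs → concat (push e cs) ≡ e ∷ concat cs
    concat-push [] = refl
    concat-push (c ∷ cs) with weight (e ∷ c) ≤? K
    ... | yes _ = refl
    ... | no _ = refl

  chunks-light : 1 ≤ K → ∀ es → All (λ c → weight c ≤ K) (chunks es)
  chunks-light 1≤K [] = []
  chunks-light 1≤K (e ∷ es) = push-light (chunks es) (chunks-light 1≤K es)
    where
    single : weight (e ∷ []) ≤ K
    single = ≤-trans (≤-reflexive (+-identityʳ (w e))) (≤-trans (w≤1 e) 1≤K)
    push-light : ∀ cs → All (λ c → weight c ≤ K) cs → All (λ c → weight c ≤ K) (push e cs)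
    push-light [] [] = single ∷ []
    push-light (c ∷ cs) (c≤K ∷ cs≤K) with weight (e ∷ c) ≤? K
    ... | yes ec≤K = ec≤K ∷ cs≤K
    ... | no _ = single ∷ c≤K ∷ cs≤K

  -- all chunks but the first are full, in the aggregate form preserved by push
  Full : List (List E) → Set
  Full [] = ⊤
  Full (_ ∷ cs) = K * length cs ≤ weight (concat cs)

  chunks-full : ∀ es → Full (chunks es)
  chunks-full [] = tt
  chunks-full (e ∷ es) = push-full (chunks es) (chunks-full es)
    where
    push-full : ∀ cs → Full cs → Full (push e cs)
    push-full [] _ = ≤-reflexive (*-zeroʳ K)
    push-full (c ∷ cs) full with weight (e ∷ c) ≤? K
    ... | yes _ = full
    ... | no ec≰K = begin
      K * suc (length cs)            ≡⟨ *-suc K (length cs) ⟩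
      K + K * length cs              ≤⟨ +-mono-≤ K≤c full ⟩
      weight c + weight (concat cs)  ≡⟨ weight-++ c (concat cs) ⟨
      weight (c ++ concat cs)        ∎
      where
      open ≤-Reasoning
      K≤c : K ≤ weight c
      K≤c = ≤-pred (≤-trans (≰⇒> ec≰K) (+-monoˡ-≤ (weight c) (w≤1 e)))

  length-chunks : ∀ es → K * length (chunks es) ≤ weight es + K
  length-chunks es with chunks es | chunks-full es | concat-chunks es
  ... | [] | _ | _ = ≤-trans (≤-reflexive (*-zeroʳ K)) z≤n
  ... | c ∷ cs | full | refl = begin
    K * suc (length cs)                ≡⟨ *-suc K (length cs) ⟩
    K + K * length cs                  ≤⟨ +-monoʳ-≤ K (≤-trans full (m≤n+m _ (weight c))) ⟩
    K + (weight c + weight (concat cs)) ≡⟨ cong (K +_) (weight-++ c (concat cs)) ⟨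
    K + weight (c ++ concat cs)        ≡⟨ +-comm K _ ⟩
    weight (c ++ concat cs) + K        ∎
    where open ≤-Reasoning

module WordMachine {n : ℕ} (G : Family n) (M : ℕ) where
  open CDAG G using (Vtx; Valid; IsInput; preds)

  data Event : Set where
    calc load store : Vtx → Event
    evict : Event

  record Config : Set where
    constructor ⟨_,_⟩
    field
      cache slow : List Vtx
  open Config public

  Held : Config → Vtx → Set
  Held s u = u ∈ cache s ⊎ u ∈ slow s

  data _—[_]→_ : Config → Event → Config → Set where
    step-calc  : ∀ {c m v} → Valid v → ¬ IsInput v → All (_∈ c) (preds v) → length (v ∷ c) ≤ M →
                 ⟨ c , m ⟩ —[ calc v ]→ ⟨ v ∷ c , m ⟩
    step-load  : ∀ {c m v} → v ∈ m → length (v ∷ c) ≤ M → ⟨ c , m ⟩ —[ load v ]→ ⟨ v ∷ c , m ⟩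
    step-store : ∀ {c m v} → v ∈ c → ⟨ c , m ⟩ —[ store v ]→ ⟨ c , v ∷ m ⟩
    step-evict : ∀ {c c′ m} → c′ ⊆ c → length c′ ≤ M → ⟨ c , m ⟩ —[ evict ]→ ⟨ c′ , m ⟩

  data _—[_]↠_ : Config → List Event → Config → Set where
    done : ∀ {s} → s —[ [] ]↠ s
    _∷_  : ∀ {s e s′ es s″} → s —[ e ]→ s′ → s′ —[ es ]↠ s″ → s —[ e ∷ es ]↠ s″

  calcOf loadOf storeOf : Event → List Vtx
  calcOf (calc v) = v ∷ []
  calcOf _ = []
  loadOf (load v) = v ∷ []
  loadOf _ = []
  storeOf (store v) = v ∷ []
  storeOf _ = []

  calcs loads stores : List Event → List Vtx
  calcs = concatMap calcOf
  loads = concatMap loadOf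
  stores = concatMap storeOf

  io : List Event → ℕ
  io es = length (loads es) + length (stores es)

  io-++ : ∀ xs ys → io (xs ++ ys) ≡ io xs + io ys
  io-++ xs ys rewrite concatMap-++ loadOf xs ys | concatMap-++ storeOf xs ys
                    | length-++ (loads xs) {loads ys} | length-++ (stores xs) {stores ys} =
    interchange (length (loads xs)) _ _ _

  ↠-++ : ∀ {s xs s′ ys s″} → s —[ xs ]↠ s′ → s′ —[ ys ]↠ s″ → s —[ xs ++ ys ]↠ s″
  ↠-++ done r = r
  ↠-++ (st ∷ r₁) r₂ = st ∷ ↠-++ r₁ r₂

  ↠-split : ∀ {s} xs {ys s″} → s —[ xs ++ ys ]↠ s″ → Σ Config λ s′ → s —[ xs ]↠ s′ × s′ —[ ys ]↠ s″
  ↠-split [] r = _ , done , r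
  ↠-split (_ ∷ xs) (st ∷ r) with s′ , r₁ , r₂ ← ↠-split xs r = s′ , st ∷ r₁ , r₂

  cache-bounded : ∀ {s es s′} → s —[ es ]↠ s′ → length (cache s) ≤ M → length (cache s′) ≤ M
  cache-bounded done c≤M = c≤M
  cache-bounded (step-calc _ _ _ c≤M ∷ r) _ = cache-bounded r c≤M
  cache-bounded (step-load _ c≤M ∷ r) _ = cache-bounded r c≤M
  cache-bounded (step-store _ ∷ r) c≤M = cache-bounded r c≤M
  cache-bounded (step-evict _ c≤M ∷ r) _ = cache-bounded r c≤M

  calcs-valid : ∀ {s es s′ v} → s —[ es ]↠ s′ → v ∈ calcs es → Valid v × ¬ IsInput v
  calcs-valid (step-calc valid non-input _ _ ∷ _) (here refl) = valid , non-input
  calcs-valid (step-calc _ _ _ _ ∷ r) (there v∈) = calcs-valid r v∈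
  calcs-valid (step-load _ _ ∷ r) v∈ = calcs-valid r v∈
  calcs-valid (step-store _ ∷ r) v∈ = calcs-valid r v∈
  calcs-valid (step-evict _ _ ∷ r) v∈ = calcs-valid r v∈

  cache-step⁻ : ∀ {s e s′ u} → s —[ e ]→ s′ → u ∈ cache s′ → u ∈ cache s ⊎ u ∈ loadOf e ⊎ u ∈ calcOf e
  cache-step⁻ (step-calc _ _ _ _) (here refl) = inj₂ (inj₂ (here refl))
  cache-step⁻ (step-calc _ _ _ _) (there u∈) = inj₁ u∈
  cache-step⁻ (step-load _ _) (here refl) = inj₂ (inj₁ (here refl))
  cache-step⁻ (step-load _ _) (there u∈) = inj₁ u∈
  cache-step⁻ (step-store _) u∈ = inj₁ u∈
  cache-step⁻ (step-evict c′⊆c _) u∈ = inj₁ (c′⊆c u∈)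

  held-step⁻ : ∀ {s e s′ u} → s —[ e ]→ s′ → Held s′ u → Held s u ⊎ u ∈ calcOf e
  held-step⁻ (step-calc _ _ _ _) (inj₁ (here refl)) = inj₂ (here refl)
  held-step⁻ (step-calc _ _ _ _) (inj₁ (there u∈)) = inj₁ (inj₁ u∈)
  held-step⁻ (step-calc _ _ _ _) (inj₂ u∈) = inj₁ (inj₂ u∈)
  held-step⁻ (step-load v∈m _) (inj₁ (here refl)) = inj₁ (inj₂ v∈m)
  held-step⁻ (step-load _ _) (inj₁ (there u∈)) = inj₁ (inj₁ u∈)
  held-step⁻ (step-load _ _) (inj₂ u∈) = inj₁ (inj₂ u∈)
  held-step⁻ (step-store _) (inj₁ u∈) = inj₁ (inj₁ u∈)
  held-step⁻ (step-store v∈c) (inj₂ (here refl)) = inj₁ (inj₁ v∈c)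
  held-step⁻ (step-store _) (inj₂ (there u∈)) = inj₁ (inj₂ u∈)
  held-step⁻ (step-evict c′⊆c _) (inj₁ u∈) = inj₁ (inj₁ (c′⊆c u∈))
  held-step⁻ (step-evict _ _) (inj₂ u∈) = inj₁ (inj₂ u∈)

  slow-step⁻ : ∀ {s e s′ u} → s —[ e ]→ s′ → u ∈ slow s′ → u ∈ slow s ⊎ u ∈ storeOf e
  slow-step⁻ (step-calc _ _ _ _) u∈ = inj₁ u∈
  slow-step⁻ (step-load _ _) u∈ = inj₁ u∈
  slow-step⁻ (step-store _) (here refl) = inj₂ (here refl)
  slow-step⁻ (step-store _) (there u∈) = inj₁ u∈
  slow-step⁻ (step-evict _ _) u∈ = inj₁ u∈

  calc-step-preds : ∀ {s e s′ v u} → s —[ e ]→ s′ → v ∈ calcOf e → u ∈ preds v → u ∈ cache s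
  calc-step-preds (step-calc _ _ preds⊆c _) (here refl) u∈ = All.lookup preds⊆c u∈

  load-step-slow : ∀ {s e s′ u} → s —[ e ]→ s′ → u ∈ loadOf e → u ∈ slow s
  load-step-slow (step-load v∈m _) (here refl) = v∈m

  held-↠⁻ : ∀ {s es s′ u} → s —[ es ]↠ s′ → Held s′ u → Held s u ⊎ u ∈ calcs es
  held-↠⁻ done h = inj₁ h
  held-↠⁻ {es = e ∷ _} (st ∷ r) h with held-↠⁻ r h
  ... | inj₁ h′ = Sum.map₂ ∈-++⁺ˡ (held-step⁻ st h′)
  ... | inj₂ u∈ = inj₂ (∈-++⁺ʳ (calcOf e) u∈)

  slow-↠⁻ : ∀ {s es s′ u} → s —[ es ]↠ s′ → u ∈ slow s′ → u ∈ slow s ⊎ u ∈ stores es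
  slow-↠⁻ done u∈ = inj₁ u∈
  slow-↠⁻ {es = e ∷ _} (st ∷ r) u∈ with slow-↠⁻ r u∈
  ... | inj₁ u∈′ = Sum.map₂ ∈-++⁺ˡ (slow-step⁻ st u∈′)
  ... | inj₂ u∈′ = inj₂ (∈-++⁺ʳ (storeOf e) u∈′)

  load-↠⁻ : ∀ {s es s′ u} → s —[ es ]↠ s′ → u ∈ loads es → Held s u ⊎ u ∈ calcs es
  load-↠⁻ {es = e ∷ _} (st ∷ r) u∈ with ∈-++⁻ (loadOf e) u∈
  ... | inj₁ u∈e = inj₁ (inj₂ (load-step-slow st u∈e))
  ... | inj₂ u∈es with load-↠⁻ r u∈es
  ...   | inj₁ h = Sum.map₂ ∈-++⁺ˡ (held-step⁻ st h)
  ...   | inj₂ u∈′ = inj₂ (∈-++⁺ʳ (calcOf e) u∈′)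

  pred-↠⁻ : ∀ {s es s′ v u} → s —[ es ]↠ s′ → v ∈ calcs es → u ∈ preds v →
    u ∈ cache s ⊎ u ∈ loads es ⊎ u ∈ calcs es
  pred-↠⁻ {es = e ∷ _} (st ∷ r) v∈ u∈ with ∈-++⁻ (calcOf e) v∈
  ... | inj₁ v∈e = inj₁ (calc-step-preds st v∈e u∈)
  ... | inj₂ v∈es with pred-↠⁻ r v∈es u∈
  ...   | inj₁ u∈c = Sum.map₂ (Sum.map ∈-++⁺ˡ ∈-++⁺ˡ) (cache-step⁻ st u∈c)
  ...   | inj₂ (inj₁ u∈l) = inj₂ (inj₁ (∈-++⁺ʳ (loadOf e) u∈l))
  ...   | inj₂ (inj₂ u∈c) = inj₂ (inj₂ (∈-++⁺ʳ (calcOf e) u∈c))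

  pred-held-↠⁻ : ∀ {s es s′ v u} → s —[ es ]↠ s′ → v ∈ calcs es → u ∈ preds v → Held s u ⊎ u ∈ calcs es
  pred-held-↠⁻ r v∈ u∈ with pred-↠⁻ r v∈ u∈
  ... | inj₁ u∈c = inj₁ (inj₁ u∈c)
  ... | inj₂ (inj₁ u∈l) = load-↠⁻ r u∈l
  ... | inj₂ (inj₂ u∈c) = inj₂ u∈c

  calcs-concat⁻ : ∀ cs {v} → v ∈ calcs (concat cs) → ∃ λ c → c ∈ cs × v ∈ calcs c
  calcs-concat⁻ (c ∷ cs) v∈ with ∈-++⁻ (calcs c) (subst (_ ∈_) (concatMap-++ calcOf c (concat cs)) v∈)
  ... | inj₁ v∈c = c , here refl , v∈c
  ... | inj₂ v∈cs = let c′ , c′∈ , v∈c′ = calcs-concat⁻ cs v∈cs in c′ , there c′∈ , v∈c′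

module Simulation {n : ℕ} (G : Family n) (M B : ℕ) where
  open CDAG G
  open WordMachine G M

  -- A block transfer of ws is simulated word by word, last word first, so that ws ends up on top of the cache.
  transfer : (Vtx → Event) → List Vtx → List Event
  transfer f [] = []
  transfer f (w ∷ ws) = transfer f ws ++ f w ∷ []

  calcs-transfer : ∀ {f} → (∀ w → calcs (f w ∷ []) ≡ []) → ∀ ws → calcs (transfer f ws) ≡ []
  calcs-transfer no-calc [] = refl
  calcs-transfer {f} no-calc (w ∷ ws) = begin
    calcs (transfer f ws ++ f w ∷ [])          ≡⟨ concatMap-++ calcOf (transfer f ws) (f w ∷ []) ⟩
    calcs (transfer f ws) ++ calcs (f w ∷ []) ≡⟨ cong₂ _++_ (calcs-transfer no-calc ws) (no-calc w) ⟩
    []                                         ∎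
    where open ≡-Reasoning

  io-transfer : ∀ {f} → (∀ w → io (f w ∷ []) ≡ 1) → ∀ ws → io (transfer f ws) ≡ length ws
  io-transfer one-io [] = refl
  io-transfer {f} one-io (w ∷ ws) = begin
    io (transfer f ws ++ f w ∷ [])   ≡⟨ io-++ (transfer f ws) (f w ∷ []) ⟩
    io (transfer f ws) + io (f w ∷ []) ≡⟨ cong₂ _+_ (io-transfer one-io ws) (one-io w) ⟩
    length ws + 1                    ≡⟨ +-comm (length ws) 1 ⟩
    suc (length ws)                  ∎
    where open ≡-Reasoning

  loadAll-↠ : ∀ {ws c m} → All (_∈ m) ws → length (ws ++ c) ≤ M →
    ⟨ c , m ⟩ —[ transfer load ws ]↠ ⟨ ws ++ c , m ⟩
  loadAll-↠ [] _ = done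
  loadAll-↠ (w∈m ∷ ws⊆m) ≤M = ↠-++ (loadAll-↠ ws⊆m (≤-trans (n≤1+n _) ≤M)) (step-load w∈m ≤M ∷ done)

  storeAll-↠ : ∀ {ws c m} → All (_∈ c) ws → ⟨ c , m ⟩ —[ transfer store ws ]↠ ⟨ c , ws ++ m ⟩
  storeAll-↠ [] = done
  storeAll-↠ (w∈c ∷ ws⊆c) = ↠-++ (storeAll-↠ ws⊆c) (step-store w∈c ∷ done)

  block-io : ∀ f ws {k} → (∀ w → io (f w ∷ []) ≡ 1) → length ws ≤ B → io (transfer f ws) + B * k ≤ B * suc k
  block-io f ws {k} one-io ws≤B = begin
    io (transfer f ws) + B * k ≡⟨ cong (_+ B * k) (io-transfer one-io ws) ⟩
    length ws + B * k          ≤⟨ +-monoˡ-≤ (B * k) ws≤B ⟩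
    B + B * k                  ≡⟨ *-suc B k ⟨
    B * suc k                  ∎
    where open ≤-Reasoning

  Covers : Mem → List Vtx → Set
  Covers m sl = ∀ a v → m a ≡ just v → v ∈ sl

  Consec⇒⊆ : ∀ {m sl a ws} → Covers m sl → Consec m a ws → All (_∈ sl) ws
  Consec⇒⊆ {ws = []} _ _ = []
  Consec⇒⊆ {a = a} {w ∷ _} covers (ma≡w , rest) = covers a w ma≡w ∷ Consec⇒⊆ covers rest

  writeAt⁻ : ∀ m a ws b {v} → writeAt m a ws b ≡ just v → v ∈ ws ⊎ m b ≡ just v
  writeAt⁻ m a [] b eq = inj₂ eq
  writeAt⁻ m a (w ∷ ws) b eq with writeAt⁻ _ (suc a) ws b eq
  ... | inj₁ v∈ws = inj₁ (there v∈ws)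
  ... | inj₂ eq′ with b ≡ᵇ a
  ...   | false = inj₂ eq′
  writeAt⁻ m a (w ∷ ws) b eq | inj₂ refl | true = inj₁ (here refl)

  Covers-writeAt : ∀ {m sl} a ws → Covers m sl → Covers (writeAt m a ws) (ws ++ sl)
  Covers-writeAt {m} a ws covers b v eq with writeAt⁻ m a ws b eq
  ... | inj₁ v∈ws = ∈-++⁺ˡ v∈ws
  ... | inj₂ eq′ = ∈-++⁺ʳ ws (covers b v eq′)

  record Simulated (s : Config) (ops : List Op) : Set where
    field
      {events} : List Event
      {final}  : Config
      run      : s —[ events ]↠ final
      calcs≡   : calcs events ≡ computed ops
      io≤      : io events ≤ B * ioCount ops

  prepend : ∀ {s xs s′ ops ops′} → s —[ xs ]↠ s′ → Simulated s′ ops →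
    calcs xs ++ computed ops ≡ computed ops′ → io xs + B * ioCount ops ≤ B * ioCount ops′ → Simulated s ops′
  prepend {xs = xs} r sim xs-calcs xs-io = record
    { run = ↠-++ r run
    ; calcs≡ = trans (concatMap-++ calcOf xs events) (trans (cong (calcs xs ++_) calcs≡) xs-calcs)
    ; io≤ = ≤-trans (≤-reflexive (io-++ xs events)) (≤-trans (+-monoʳ-≤ (io xs) io≤) xs-io)
    }
    where open Simulated sim

  simulate : ∀ {c m ops s′} → Run M B (st c m) ops s′ → length c ≤ M → ∀ {sl} → Covers m sl →
    Simulated ⟨ c , sl ⟩ ops
  simulate done _ _ = record { run = done ; calcs≡ = refl ; io≤ = z≤n }
  simulate (stepCompute valid non-input preds⊆c ≤M ∷ r) _ covers =
    prepend (step-calc valid non-input preds⊆c ≤M ∷ done) (simulate r ≤M covers) refl ≤-refl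
  simulate (stepRead {ws = ws} _ ws≤B consec ≤M ∷ r) _ covers =
    prepend (loadAll-↠ (Consec⇒⊆ covers consec) ≤M) (simulate r ≤M covers)
      (cong (_++ _) (calcs-transfer (λ _ → refl) ws)) (block-io load ws (λ _ → refl) ws≤B)
  simulate (stepWrite {a = a} {ws = ws} _ ws≤B ws⊆c ∷ r) c≤M covers =
    prepend (storeAll-↠ ws⊆c) (simulate r c≤M (Covers-writeAt a ws covers))
      (cong (_++ _) (calcs-transfer (λ _ → refl) ws)) (block-io store ws (λ _ → refl) ws≤B)
  simulate (stepDelete {xs = xs} ∷ r) c≤M covers =
    prepend (step-evict (xs++ys⊆xs++v∷ys xs) ≤M ∷ done) (simulate r ≤M covers) refl ≤-refl
    where
    ≤M = ≤-trans (length[xs++ys]≤length[xs++v∷ys] xs) c≤M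

  initial-slow : List Vtx
  initial-slow = map inp (upTo n)

  initial-slow-inputs : ∀ {v} → v ∈ initial-slow → IsInput v
  initial-slow-inputs v∈ with _ , _ , refl ← ∈-map⁻ inp v∈ = tt

  simulate-initial : ∀ {m ops s} → InitMem m → Run M B (st [] m) ops s → Simulated ⟨ [] , initial-slow ⟩ ops
  simulate-initial init r = simulate r z≤n covered
    where
    covered : Covers _ initial-slow
    covered a v eq with i , i<n , refl ← proj₁ init a v eq = ∈-map⁺ inp (∈-upTo⁺ i<n)

module Leaves {n : ℕ} (G : Family n) where
  open Family G
  open CDAG G

  label : ∀ {t} → Pos t → Maybe ℕ
  label {leaf k} here = just k
  label {node _ _} here = nothing
  label (inl p) = label p
  label (inr p) = label p

  ∈-leaves⁺ : ∀ {t} (p : Pos t) {k} → label p ≡ just k → k ∈ leaves t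
  ∈-leaves⁺ {leaf k} here refl = here refl
  ∈-leaves⁺ {node l r} (inl p) eq = ∈-++⁺ˡ (∈-leaves⁺ p eq)
  ∈-leaves⁺ {node l r} (inr p) eq = ∈-++⁺ʳ (leaves l) (∈-leaves⁺ p eq)

  ∈-leaves⁻ : ∀ t {k} → k ∈ leaves t → Σ (Pos t) λ p → label p ≡ just k
  ∈-leaves⁻ (leaf k) (here refl) = here , refl
  ∈-leaves⁻ (node l r) k∈ with ∈-++⁻ (leaves l) k∈
  ... | inj₁ k∈l = let p , eq = ∈-leaves⁻ l k∈l in inl p , eq
  ... | inj₂ k∈r = let p , eq = ∈-leaves⁻ r k∈r in inr p , eq

  preds-leaf : ∀ i d (p : Pos (shape i d)) {k} → label p ≡ just k →
    preds (tn i d p) ≡ vOff i k ∷ vOff (i + suc k) (d ∸ k) ∷ []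
  preds-leaf i d = go (shape i d) (λ q → q)
    where
    go : ∀ t (w : Pos t → Pos (shape i d)) (p : Pos t) {k} → label p ≡ just k →
      predsAux i d t w p ≡ vOff i k ∷ vOff (i + suc k) (d ∸ k) ∷ []
    go (leaf k) w here refl = refl
    go (node l r) w (inl p) eq = go l (λ q → w (inl q)) p eq
    go (node l r) w (inr p) eq = go r (λ q → w (inr q)) p eq

  label≤ : ∀ i d (p : Pos (shape i d)) {k} → i + suc d < n → label p ≡ just k → k ≤ d
  label≤ i d p valid eq = ≤-pred (∈-upTo⁻ (∈-resp-↭ (labels i d valid) (∈-leaves⁺ p eq)))

  leaf-with-label : ∀ i d {k} → i + suc d < n → k ≤ d → Σ (Pos (shape i d)) λ p → label p ≡ just k
  leaf-with-label i d valid k≤d = ∈-leaves⁻ (shape i d) (∈-resp-↭ (↭-sym (labels i d valid)) (∈-upTo⁺ (s≤s k≤d)))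

  -- span v = (i , j) for the paper's v_{i,j} and for every vertex of the tree rooted at it
  span : Vtx → ℕ × ℕ
  span (inp i) = i , i
  span (tn i d _) = i , i + suc d

  span-vOff : ∀ i off → span (vOff i off) ≡ (i , i + off)
  span-vOff i zero = cong (i ,_) (sym (+-identityʳ i))
  span-vOff i (suc off) = refl

  tripleOf : Vtx → List (ℕ × ℕ × ℕ)
  tripleOf (inp _) = []
  tripleOf (tn i d p) = maybe (λ k → (i , i + k , i + suc d) ∷ []) [] (label p)

  triplesOf : List Vtx → List (ℕ × ℕ × ℕ)
  triplesOf = concatMap tripleOf

  data IsLeafOf : Vtx → ℕ × ℕ × ℕ → Set where
    leaf-of : ∀ {i d k} (p : Pos (shape i d)) → label p ≡ just k → IsLeafOf (tn i d p) (i , i + k , i + suc d)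

  ∈-tripleOf⁻ : ∀ v {t} → t ∈ tripleOf v → IsLeafOf v t
  ∈-tripleOf⁻ (tn i d p) t∈ with label p in eq
  ∈-tripleOf⁻ (tn i d p) (here refl) | just k = leaf-of p eq

  leaf-of-triple : ∀ {x y z} → (x , y , z) ∈ triples n →
    Σ Vtx λ v → Valid v × ¬ IsInput v × (x , y , z) ∈ tripleOf v
  leaf-of-triple {x} {y} {z} t∈ with x≤y , y<z , z<n ← ∈-triples⁻ n t∈
    with d , refl ← m≤n⇒∃[o]m+o≡n (≤-<-trans x≤y y<z)
    with k , refl ← m≤n⇒∃[o]m+o≡n x≤y =
    tn x d p , valid , (λ ()) , subst (λ z → (x , x + k , z) ∈ tripleOf (tn x d p)) (+-suc x d) t∈p
    where
    valid : x + suc d < n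
    valid = subst (_< n) (sym (+-suc x d)) z<n
    leaf-k = leaf-with-label x d valid (+-cancelˡ-≤ x k d (≤-pred y<z))
    p = proj₁ leaf-k
    t∈p : (x , x + k , x + suc d) ∈ tripleOf (tn x d p)
    t∈p with label p | proj₂ leaf-k
    ... | just .k | refl = here refl

  IsRoot : Vtx → Set
  IsRoot v = ∃₂ λ i d → v ≡ tn i d here

  here? : ∀ {t} (p : Pos t) → Dec (p ≡ here)
  here? here = yes refl
  here? (inl _) = no λ ()
  here? (inr _) = no λ ()

  isRoot? : Decidable IsRoot
  isRoot? (inp _) = no λ ()
  isRoot? (tn i d p) with here? p
  ... | yes refl = yes (i , d , refl)
  ... | no p≢here = no λ { (_ , _ , refl) → p≢here refl }

  roots : List Vtx → List Vtx
  roots = filter isRoot?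

  leaf-above-inputs : ∀ j → j + 1 < n → Σ Vtx λ v → Valid v × ¬ IsInput v × preds v ≡ inp j ∷ inp (j + 1) ∷ []
  leaf-above-inputs j valid = tn j 0 p , valid , (λ ()) , preds-leaf j 0 p eq
    where
    leaf-0 = leaf-with-label j 0 valid z≤n
    p = proj₁ leaf-0
    eq = proj₂ leaf-0

  -- each input v_{i,i} feeds the leaf of the tree rooted at v_{i,i+1}, or, for the last one, at v_{i-1,i}
  input-feeds-leaf : 2 ≤ n → ∀ {i} → i < n → Σ Vtx λ v → Valid v × ¬ IsInput v × inp i ∈ preds v
  input-feeds-leaf 2≤n {i} i<n with i + 1 <? n
  ... | yes i+1<n = let v , valid , non-input , eq = leaf-above-inputs i i+1<n in
    v , valid , non-input , subst (inp i ∈_) (sym eq) (here refl)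
  input-feeds-leaf 2≤n {zero} i<n | no 1≮n = contradiction 2≤n 1≮n
  input-feeds-leaf 2≤n {suc j} i<n | no _ =
    let v , valid , non-input , eq = leaf-above-inputs j (subst (_< n) (+-comm 1 j) i<n) in
    v , valid , non-input , subst (inp (suc j) ∈_) (sym eq) (there (here (cong inp (+-comm 1 j))))

module Schedules {n : ℕ} (G : Family n) (M : ℕ) where
  open import Data.List.Membership.DecPropositional (≡-dec _≟_ (≡-dec _≟_ _≟_)) using (_∈?_)
  open Family G
  open CDAG G
  open WordMachine G M
  open Leaves G

  cost : List Event → ℕ
  cost es = io es + length (roots (calcs es))

  module Schedule (m₀ : List Vtx) (m₀-inputs : ∀ {v} → v ∈ m₀ → IsInput v)
    {es : List Event} {s : Config} (run : ⟨ [] , m₀ ⟩ —[ es ]↠ s) (es! : Unique (calcs es))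
    (all-calc : ∀ v → Valid v → ¬ IsInput v → v ∈ calcs es) where

    module Segment {pre seg post} (split : pre ++ seg ++ post ≡ es) where

      private
        run′ : ⟨ [] , m₀ ⟩ —[ pre ++ seg ++ post ]↠ s
        run′ = subst (λ es → ⟨ [] , m₀ ⟩ —[ es ]↠ s) (sym split) run
        split₁ = ↠-split pre run′
        split₂ = ↠-split seg (proj₂ (proj₂ split₁))

      sA sB : Config
      sA = proj₁ split₁
      sB = proj₁ split₂

      r₁ : ⟨ [] , m₀ ⟩ —[ pre ]↠ sA
      r₁ = proj₁ (proj₂ split₁)
      r₂ : sA —[ seg ]↠ sB
      r₂ = proj₁ (proj₂ split₂)
      r₃ : sB —[ post ]↠ s
      r₃ = proj₂ (proj₂ split₂)

      calcs-split : calcs pre ++ calcs seg ++ calcs post ≡ calcs es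
      calcs-split = trans (cong (calcs pre ++_) (sym (concatMap-++ calcOf seg post)))
                          (trans (sym (concatMap-++ calcOf pre (seg ++ post))) (cong calcs split))

      split! : Unique (calcs pre ++ calcs seg ++ calcs post)
      split! = subst Unique (sym calcs-split) es!

      pre∩seg : ∀ {v} → v ∈ calcs pre → v ∈ calcs seg → ⊥
      pre∩seg v∈pre v∈seg = Unique[xs++ys]⇒Disjoint (calcs pre) split! (v∈pre , ∈-++⁺ˡ v∈seg)

      seg∩post : ∀ {v} → v ∈ calcs seg → v ∈ calcs post → ⊥
      seg∩post v∈seg v∈post =
        Unique[xs++ys]⇒Disjoint (calcs seg) (Unique[xs++ys]⇒Unique[ys] (calcs pre) split!) (v∈seg , v∈post)

      calc-time : ∀ {v} → Valid v → ¬ IsInput v → v ∈ calcs pre ⊎ v ∈ calcs seg ⊎ v ∈ calcs post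
      calc-time {v} valid non-input with ∈-++⁻ (calcs pre) (subst (v ∈_) (sym calcs-split) (all-calc v valid non-input))
      ... | inj₁ v∈pre = inj₁ v∈pre
      ... | inj₂ v∈rest = inj₂ (∈-++⁻ (calcs seg) v∈rest)

      slowA⇒pre : ∀ {u} → ¬ IsInput u → u ∈ slow sA → u ∈ calcs pre
      slowA⇒pre non-input u∈ with held-↠⁻ r₁ (inj₂ u∈)
      ... | inj₁ (inj₁ ())
      ... | inj₁ (inj₂ u∈m₀) = contradiction (m₀-inputs u∈m₀) non-input
      ... | inj₂ u∈pre = u∈pre

      available surviving : List Vtx
      available = cache sA ++ loads seg ++ roots (calcs seg)
      surviving = cache sB ++ stores seg ++ roots (calcs seg)

      vOff-available : ∀ {v} i off → v ∈ calcs seg → vOff i off ∈ preds v → vOff i off ∈ available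
      vOff-available i off v∈ u∈ with pred-↠⁻ r₂ v∈ u∈
      ... | inj₁ u∈c = ∈-++⁺ˡ u∈c
      ... | inj₂ (inj₁ u∈l) = ∈-++⁺ʳ (cache sA) (∈-++⁺ˡ u∈l)
      ... | inj₂ (inj₂ u∈s) = ∈-++⁺ʳ (cache sA) (∈-++⁺ʳ (loads seg) (computed-root off u∈s))
        where
        computed-root : ∀ off → vOff i off ∈ calcs seg → vOff i off ∈ roots (calcs seg)
        computed-root zero u∈ = contradiction tt (proj₂ (calcs-valid r₂ u∈))
        computed-root (suc off) u∈ = ∈-filter⁺ isRoot? u∈ (i , off , refl)

      module _ (i d : ℕ) (valid : i + suc d < n) where

        Survives : Pos (shape i d) → Set
        Survives q = tn i d q ∈ calcs seg → ∃ λ u → u ∈ surviving × span u ≡ (i , i + suc d)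

        root-survives : Survives here
        root-survives r∈ =
          tn i d here , ∈-++⁺ʳ (cache sB) (∈-++⁺ʳ (stores seg) (∈-filter⁺ isRoot? r∈ (i , d , refl))) , refl

        -- A parent not computed in the segment is computed after it, so a child computed in the segment
        -- is still held when the segment ends: in the cache, or in slow memory, stored during the segment.
        child-survives : ∀ q q′ → tn i d q′ ∈ preds (tn i d q) → Survives q → Survives q′
        child-survives q q′ q′∈ survives q′∈seg with calc-time {tn i d q} valid (λ ())
        ... | inj₂ (inj₁ q∈seg) = survives q∈seg
        ... | inj₁ q∈pre with pred-held-↠⁻ r₁ q∈pre q′∈
        ...   | inj₁ (inj₁ ())
        ...   | inj₁ (inj₂ q′∈m₀) = ⊥-elim (m₀-inputs q′∈m₀)
        ...   | inj₂ q′∈pre = ⊥-elim (pre∩seg q′∈pre q′∈seg)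
        child-survives q q′ q′∈ survives q′∈seg | inj₂ (inj₂ q∈post) with pred-held-↠⁻ r₃ q∈post q′∈
        ... | inj₁ (inj₁ q′∈cB) = tn i d q′ , ∈-++⁺ˡ q′∈cB , refl
        ... | inj₂ q′∈post = ⊥-elim (seg∩post q′∈seg q′∈post)
        ... | inj₁ (inj₂ q′∈slowB) with slow-↠⁻ r₂ q′∈slowB
        ...   | inj₂ q′∈stores = tn i d q′ , ∈-++⁺ʳ (cache sB) (∈-++⁺ˡ q′∈stores) , refl
        ...   | inj₁ q′∈slowA = ⊥-elim (pre∩seg (slowA⇒pre (λ ()) q′∈slowA) q′∈seg)

        all-survive : ∀ p → Survives p
        all-survive = descend (shape i d) (λ q → q) (λ _ → refl) root-survives
          where
          descend : ∀ t (w : Pos t → Pos (shape i d)) → (∀ p → preds (tn i d (w p)) ≡ predsAux i d t w p) →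
            Survives (w here) → ∀ p → Survives (w p)
          descend t w _ survives here = survives
          descend (node l r) w preds≡ survives (inl p) =
            descend l (λ q → w (inl q)) (λ q → preds≡ (inl q))
              (child-survives (w here) (w (inl here)) (subst (_ ∈_) (sym (preds≡ here)) (here refl)) survives) p
          descend (node l r) w preds≡ survives (inr p) =
            descend r (λ q → w (inr q)) (λ q → preds≡ (inr q))
              (child-survives (w here) (w (inr here)) (subst (_ ∈_) (sym (preds≡ here)) (there (here refl))) survives) p

      -- the right predecessor v_{y+1,z} of a leaf (x , y , z) is recorded under (y , z)
      shift : ℕ × ℕ → ℕ × ℕ
      shift (a , b) = a ∸ 1 , b

      P₁ P₂ P₃ : List (ℕ × ℕ)
      P₁ = map span available
      P₂ = map (shift ∘ span) available
      P₃ = map span surviving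

      triple-projections : ∀ {x y z} → (x , y , z) ∈ triplesOf (calcs seg) →
        (x , y) ∈ P₁ × (y , z) ∈ P₂ × (x , z) ∈ P₃
      triple-projections t∈ with v , v∈ , t∈v ← find (∈-concatMap⁻ tripleOf {xs = calcs seg} t∈)
        with ∈-tripleOf⁻ v t∈v
      ... | leaf-of {i} {d} {k} p eq =
        subst (_∈ P₁) (span-vOff i k) (∈-map⁺ span (vOff-available i k v∈ left∈)) ,
        subst (_∈ P₂) right-span (∈-map⁺ (shift ∘ span) (vOff-available (i + suc k) (d ∸ k) v∈ right∈)) ,
        subst (_∈ P₃) (proj₂ (proj₂ survivor)) (∈-map⁺ span (proj₁ (proj₂ survivor)))
        where
        preds≡ = preds-leaf i d p eq
        left∈ = subst (_ ∈_) (sym preds≡) (here refl)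
        right∈ = subst (_ ∈_) (sym preds≡) (there (here refl))
        valid = proj₁ (calcs-valid r₂ v∈)
        survivor = all-survive i d valid p v∈
        right-span : shift (span (vOff (i + suc k) (d ∸ k))) ≡ (i + k , i + suc d)
        right-span = trans (cong shift (span-vOff (i + suc k) (d ∸ k))) (cong₂ _,_
          (cong (_∸ 1) (+-suc i k))
          (trans (+-assoc i (suc k) (d ∸ k)) (cong (λ j → i + suc j) (m+[n∸m]≡n (label≤ i d p valid eq)))))

      length-available : length available ≤ M + cost seg
      length-available = begin
        length (cache sA ++ loads seg ++ roots (calcs seg))      ≡⟨ length-++ (cache sA) ⟩
        length (cache sA) + length (loads seg ++ roots (calcs seg)) ≡⟨ cong (length (cache sA) +_) (length-++ (loads seg)) ⟩
        length (cache sA) + (ℓ (loads seg) + R)                  ≤⟨ +-mono-≤ (cache-bounded r₁ z≤n)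
                                                                              (+-monoˡ-≤ R (m≤m+n _ _)) ⟩
        M + cost seg                                             ∎
        where
        open ≤-Reasoning
        ℓ = length {A = Vtx}
        R = ℓ (roots (calcs seg))

      length-surviving : length surviving ≤ M + cost seg
      length-surviving = begin
        length (cache sB ++ stores seg ++ roots (calcs seg))      ≡⟨ length-++ (cache sB) ⟩
        length (cache sB) + length (stores seg ++ roots (calcs seg)) ≡⟨ cong (length (cache sB) +_) (length-++ (stores seg)) ⟩
        length (cache sB) + (ℓ (stores seg) + R)                  ≤⟨ +-mono-≤ (cache-bounded r₂ (cache-bounded r₁ z≤n))
                                                                              (+-monoˡ-≤ R (m≤n+m _ (ℓ (loads seg)))) ⟩
        M + cost seg                                              ∎
        where
        open ≤-Reasoning
        ℓ = length {A = Vtx}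
        R = ℓ (roots (calcs seg))

      segment-bound : (T : List (ℕ × ℕ × ℕ)) → Unique T → (∀ {t} → t ∈ T → t ∈ triplesOf (calcs seg)) →
        length T * length T ≤ (M + cost seg) * ((M + cost seg) * (M + cost seg))
      segment-bound T T! T⊆ = begin
        length T * length T                 ≤⟨ loomis-whitney _≟_ T T! P₁ P₂ P₃ (triple-projections ∘ T⊆) ⟩
        length P₂ * (length P₁ * length P₃) ≤⟨ *-mono-≤ |P₂| (*-mono-≤ |P₁| |P₃|) ⟩
        (M + cost seg) * ((M + cost seg) * (M + cost seg)) ∎
        where
        open ≤-Reasoning
        |P₁| = ≤-trans (≤-reflexive (length-map span available)) length-available
        |P₂| = ≤-trans (≤-reflexive (length-map (shift ∘ span) available)) length-available
        |P₃| = ≤-trans (≤-reflexive (length-map span surviving)) length-surviving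

    cost-++ : ∀ xs ys → cost (xs ++ ys) ≡ cost xs + cost ys
    cost-++ xs ys rewrite io-++ xs ys | concatMap-++ calcOf xs ys | filter-++ isRoot? (calcs xs) (calcs ys)
                        | length-++ (roots (calcs xs)) {roots (calcs ys)} =
      interchange (io xs) (io ys) _ _

    event-cost≤1 : ∀ e → cost (e ∷ []) ≤ 1
    event-cost≤1 (calc v) with isRoot? v
    ... | yes _ = ≤-refl
    ... | no _ = z≤n
    event-cost≤1 (load _) = ≤-refl
    event-cost≤1 (store _) = ≤-refl
    event-cost≤1 evict = z≤n

    open Chunking (λ e → cost (e ∷ [])) event-cost≤1 (2 * M) public

    weight≡cost : ∀ es → weight es ≡ cost es
    weight≡cost [] = refl
    weight≡cost (e ∷ es) = trans (cong (cost (e ∷ []) +_) (weight≡cost es)) (sym (cost-++ (e ∷ []) es))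

    [3M]³ : ℕ
    [3M]³ = (3 * M) * ((3 * M) * (3 * M))

    module Covered = Fibres (λ c t → t ∈ triplesOf (calcs c)) (λ c t → t ∈? triplesOf (calcs c))

    chunk-bound : 1 ≤ M → ∀ {c} → c ∈ chunks es →
      length (Covered.fibre (triples n) c) * length (Covered.fibre (triples n) c) ≤ [3M]³ * 1
    chunk-bound 1≤M {c} c∈ with cs₁ , cs₂ , chunks≡ ← ∈-∃++ c∈ = begin
      length T * length T                                ≤⟨ Segment.segment-bound {concat cs₁} {c} {concat cs₂} split T T! T⊆ ⟩
      (M + cost c) * ((M + cost c) * (M + cost c))       ≤⟨ *-mono-≤ M+c≤3M (*-mono-≤ M+c≤3M M+c≤3M) ⟩
      [3M]³                                              ≡⟨ *-identityʳ [3M]³ ⟨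
      [3M]³ * 1                                          ∎
      where
      open ≤-Reasoning
      T = Covered.fibre (triples n) c
      T! = Unique.filter⁺ (λ t → t ∈? triplesOf (calcs c)) (triples-unique n)
      T⊆ : ∀ {t} → t ∈ T → t ∈ triplesOf (calcs c)
      T⊆ = proj₂ ∘ ∈-filter⁻ (λ t → t ∈? triplesOf (calcs c)) {xs = triples n}
      split : concat cs₁ ++ c ++ concat cs₂ ≡ es
      split = trans (concat-++ cs₁ (c ∷ cs₂)) (trans (cong concat (sym chunks≡)) (concat-chunks es))
      M+c≤3M : M + cost c ≤ 3 * M
      M+c≤3M = begin
        M + cost c      ≡⟨ cong (M +_) (weight≡cost c) ⟨
        M + weight c    ≤⟨ +-monoʳ-≤ M (All.lookup (chunks-light (≤-trans 1≤M (m≤m+n M (M + 0))) es) c∈) ⟩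
        3 * M           ∎

    calcs-chunks : calcs es ≡ calcs (concat (chunks es))
    calcs-chunks = cong calcs (sym (concat-chunks es))

    triple-in-chunk : ∀ {t} → t ∈ triples n → ∃ λ c → c ∈ chunks es × t ∈ triplesOf (calcs c)
    triple-in-chunk t∈
      with v , valid , non-input , t∈v ← leaf-of-triple t∈
      with c , c∈ , v∈c ← calcs-concat⁻ (chunks es) (subst (_ ∈_) calcs-chunks (all-calc v valid non-input)) =
      c , c∈ , ∈-concatMap⁺ tripleOf (lose v∈c t∈v)

    triples-bound : 1 ≤ M →
      length (triples n) * length (triples n) ≤ [3M]³ * (length (chunks es) * length (chunks es))
    triples-bound 1≤M = begin
      length (triples n) * length (triples n) ≤⟨ *-mono-≤ covered covered ⟩
      ∑ * ∑                                   ≤⟨ cauchy-schwarz [3M]³ (length ∘ Covered.fibre (triples n))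
                                                    (λ _ → 1) (λ _ → 1) (chunks es) (chunk-bound 1≤M) ⟩
      [3M]³ * (ones * ones)                   ≡⟨ cong (λ N → [3M]³ * (N * N)) (sum-map-const-1 (chunks es)) ⟩
      [3M]³ * (length (chunks es) * length (chunks es)) ∎
      where
      open ≤-Reasoning
      ∑ = Covered.∑fibre (chunks es) (triples n)
      ones = sum (map (λ _ → 1) (chunks es))
      covered : length (triples n) ≤ ∑
      covered = Covered.length≤∑fibre (chunks es) (triples n) triple-in-chunk

    chunk-count : 2 * M * length (chunks es) ≤ cost es + 2 * M
    chunk-count = subst (λ W → 2 * M * length (chunks es) ≤ W + 2 * M) (weight≡cost es) (length-chunks es)

    roots-bound : length (roots (calcs es)) ≤ length (pairs≤ n)
    roots-bound = injective⇒length≤ span (Unique.filter⁺ isRoot? es!) injective into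
      where
      injective : ∀ {a b} → a ∈ roots (calcs es) → b ∈ roots (calcs es) → span a ≡ span b → a ≡ b
      injective a∈ b∈ span≡ with ∈-filter⁻ isRoot? {xs = calcs es} a∈ | ∈-filter⁻ isRoot? {xs = calcs es} b∈
      ... | _ , i , d , refl | _ , i′ , d′ , refl with refl ← cong proj₁ span≡
        with refl ← suc-injective (+-cancelˡ-≡ i (suc d) (suc d′) (cong proj₂ span≡)) = refl
      into : ∀ {a} → a ∈ roots (calcs es) → span a ∈ pairs≤ n
      into a∈ with a∈es , i , d , refl ← ∈-filter⁻ isRoot? {xs = calcs es} a∈ =
        ∈-pairs≤⁺ (m≤m+n i (suc d)) (proj₁ (calcs-valid run a∈es))

    loads-bound : 2 ≤ n → n ≤ length (loads es)
    loads-bound 2≤n = subst (_≤ length (loads es)) (length-upTo n)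
      (injective⇒length≤ inp (Unique.upTo⁺ n) (λ { _ _ refl → refl }) loaded)
      where
      loaded : ∀ {i} → i ∈ upTo n → inp i ∈ loads es
      loaded i∈ with v , valid , non-input , i∈preds ← input-feeds-leaf 2≤n (∈-upTo⁻ i∈)
        with pred-↠⁻ run (all-calc v valid non-input) i∈preds
      ... | inj₁ ()
      ... | inj₂ (inj₁ i∈loads) = i∈loads
      ... | inj₂ (inj₂ i∈calcs) = contradiction tt (proj₂ (calcs-valid run i∈calcs))

io-arithmetic : ∀ M L N W X S k →
  L * L ≤ (3 * M) * ((3 * M) * (3 * M)) * (N * N) → 2 * M * N ≤ W + 2 * M → W ≤ X + S → 2 * S ≤ k →
  (6 * L) ^ 2 ≤ 64 * M * (2 * X + k + 6 * M) ^ 2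
io-arithmetic M L N W X S k L²≤ 2MN≤ W≤ 2S≤k = *-cancelˡ-≤ 4 (begin
  4 * (6 * L) ^ 2                                 ≡⟨ cong (4 *_) (m^2≡m*m (6 * L)) ⟩
  4 * ((6 * L) * (6 * L))                         ≡⟨ step₁ L ⟩
  144 * (L * L)                                   ≤⟨ *-monoʳ-≤ 144 L²≤ ⟩
  144 * ((3 * M) * ((3 * M) * (3 * M)) * (N * N)) ≡⟨ step₂ M N ⟩
  972 * M * ((2 * M * N) * (2 * M * N))           ≤⟨ *-monoʳ-≤ (972 * M) (*-mono-≤ 2MN≤ 2MN≤) ⟩
  972 * M * ((W + 2 * M) * (W + 2 * M))           ≡⟨ step₃ M W ⟩
  243 * M * ((2 * W + 4 * M) * (2 * W + 4 * M))   ≤⟨ *-mono-≤ (*-monoˡ-≤ M (m≤m+n 243 13)) (*-mono-≤ 2W+4M≤ 2W+4M≤) ⟩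
  256 * M * (Y * Y)                               ≡⟨ step₄ M Y ⟩
  4 * (64 * M * (Y * Y))                          ≡⟨ cong (λ y → 4 * (64 * M * y)) (m^2≡m*m Y) ⟨
  4 * (64 * M * Y ^ 2)                            ∎)
  where
  open ≤-Reasoning
  Y = 2 * X + k + 6 * M
  2W+4M≤ : 2 * W + 4 * M ≤ Y
  2W+4M≤ = +-mono-≤ (≤-trans (*-monoʳ-≤ 2 W≤) (≤-trans (≤-reflexive (*-distribˡ-+ 2 X S)) (+-monoʳ-≤ (2 * X) 2S≤k)))
                    (*-monoˡ-≤ M (m≤m+n 4 2))
  step₁ : ∀ L → 4 * ((6 * L) * (6 * L)) ≡ 144 * (L * L)
  step₁ = solve-∀
  step₂ : ∀ M N → 144 * ((3 * M) * ((3 * M) * (3 * M)) * (N * N)) ≡ 972 * M * ((2 * M * N) * (2 * M * N))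
  step₂ = solve-∀
  step₃ : ∀ M W → 972 * M * ((W + 2 * M) * (W + 2 * M)) ≡ 243 * M * ((2 * W + 4 * M) * (2 * W + 4 * M))
  step₃ = solve-∀
  step₄ : ∀ M Y → 256 * M * (Y * Y) ≡ 4 * (64 * M * (Y * Y))
  step₄ = solve-∀

theorem3 : (a b n M B : ℕ) → 3 ≤ a → 3 ≤ b → n ≡ 2 ^ a → M ≡ 2 ^ b → 1 ≤ B →
    (G : Family n) → (m0 : CDAG.Mem G) → CDAG.InitMem G m0 →
    (ops : List (CDAG.Op G)) → (s : CDAG.State G) →
    CDAG.Run G M B (CDAG.st [] m0) ops s →
    Unique (CDAG.computed G ops) →
    CDAG.EvaluatesAll G ops →
    IOBound n M B (CDAG.ioCount G ops)
theorem3 a b n M B 3≤a _ n≡2^a M≡2^b _ G m0 init ops _ execution unique evaluates =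
  ≤-trans (loads-bound 2≤n) (≤-trans (m≤m+n _ _) io≤) ,
  subst₂ _≤_ (cong (_^ 2) (sym (n³∸n≡6*length-triples n))) refl
    (io-arithmetic M L (length (chunks events)) (cost events) (B * ioCount ops) S (n * (n + 1))
      (triples-bound 1≤M) chunk-count (+-mono-≤ io≤ roots-bound) (≤-reflexive (length-pairs≤ n)))
  where
  open CDAG G
  open WordMachine G M
  open Simulation G M B
  open Schedules G M
  open Simulated (simulate-initial init execution)
  open Schedule initial-slow initial-slow-inputs run (subst Unique (sym calcs≡) unique)
    (λ v valid non-input → subst (v ∈_) (sym calcs≡) (evaluates v valid non-input))
  2≤n = subst (2 ≤_) (sym n≡2^a) (^-monoʳ-≤ 2 (≤-trans (s≤s z≤n) 3≤a))
  1≤M = subst (1 ≤_) (sym M≡2^b) (m^n>0 2 b)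
  L = length (triples n)
  S = length (pairs≤ n)
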